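{- Let $G=(V,E)$ be a connected graph and let $\widehat G=(V,E\cup F)$ with $F\subseteq\binom{V}{2}\setminus E$. For $e=st\in E\cup F$, the inequality $x_e\le 1$ defines a facet of $\mathrm{LMC}(G,\widehat G)$ if and only if there is no $uv\in F\setminus\{e\}$ such that both $s$ and $t$ are $uv$-cut-nodes with respect to $G$.
   Context: Graphs are finite, simple, undirected; $uv$ denotes $\{u,v\}$. For nodes $u,v$, a node $w\in V$ is a $uv$-cut-node (with respect to $G$) if every $uv$-path in $G$ contains $w$. A decomposition of $G$ is a partition $\Pi$ of $V$ such that each block induces a connected subgraph of $G$; the multicut of $\widehat G$ lifted from $G$ induced by $\Pi$ is the set of edges of $E\cup F$ whose endpoints lie in distinct blocks of $\Pi$. $\mathrm{LMC}(G,\widehat G)\subseteq\mathbb{R}^{E\cup F}$ is the convex hull of the characteristic vectors of all multicuts of $\widehat G$ lifted from $G$. -}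

module Defs where

open import Data.Nat using (ℕ; zero; suc)
open import Data.Fin using (Fin; zero; suc)
open import Data.Fin.Properties using (_≟_)
open import Data.Bool using (Bool; true; false)
open import Data.Product using (Σ; ∃; ∃-syntax; _×_; _,_; proj₁; proj₂)
open import Data.Sum using (_⊎_)
open import Data.List using (List; []; _∷_)
open import Data.List.Relation.Unary.All using (All)
open import Data.List.Relation.Unary.Unique.Propositional using (Unique)
open import Data.List.Membership.Propositional using (_∈_)
open import Data.Rational using (ℚ; 0ℚ; 1ℚ; _+_; _*_)
open import Relation.Nullary using (¬_; yes; no)
open import Relation.Binary.PropositionalEquality using (_≡_; _≢_)

-- Graph data.
-- Nodes: Fin n.  Edges of Ĝ = (V, E ∪ F): indexed by Fin m, with
-- endpoint map `ends` and a flag `inE e` (true: e ∈ E, false: e ∈ F).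

record LiftedGraph (n m : ℕ) : Set where
  field
    ends : Fin m → Fin n × Fin n
    inE  : Fin m → Bool

open LiftedGraph public

SamePair : ∀ {n} → Fin n × Fin n → Fin n × Fin n → Set
SamePair (a , b) (c , d) = (a ≡ c × b ≡ d) ⊎ (a ≡ d × b ≡ c)

-- Ĝ is a simple graph: no loops, no parallel edges (so E ∩ F = ∅ too)
Simple : ∀ {n m} → LiftedGraph n m → Set
Simple {n} {m} H =
  (∀ (e : Fin m) → proj₁ (ends H e) ≢ proj₂ (ends H e)) ×
  (∀ (e e′ : Fin m) → SamePair (ends H e) (ends H e′) → e ≡ e′)

AdjG : ∀ {n m} → LiftedGraph n m → Fin n → Fin n → Set
AdjG {n} {m} H u w = ∃[ e ] (inE H e ≡ true × SamePair (ends H e) (u , w))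

data Walk {n m} (H : LiftedGraph n m) : Fin n → Fin n → Set where
  here : ∀ {u} → Walk H u u
  step : ∀ {u w v} → AdjG H u w → Walk H w v → Walk H u v

walkNodes : ∀ {n m} {H : LiftedGraph n m} {u v} → Walk H u v → List (Fin n)
walkNodes {u = u} here = u ∷ []
walkNodes {u = u} (step _ p) = u ∷ walkNodes p

IsPath : ∀ {n m} {H : LiftedGraph n m} {u v} → Walk H u v → Set
IsPath p = Unique (walkNodes p)

ConnectedG : ∀ {n m} → LiftedGraph n m → Set
ConnectedG {n} H = ∀ (u v : Fin n) → Walk H u v

CutNode : ∀ {n m} → LiftedGraph n m → Fin n → Fin n → Fin n → Set
CutNode H u v w = ∀ (p : Walk H u v) → IsPath p → w ∈ walkNodes p

-- Decompositions: a partition of V given by block labels π : V → Fin n,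
-- each block inducing a connected subgraph of G.

IsDecomposition : ∀ {n m} → LiftedGraph n m → (Fin n → Fin n) → Set
IsDecomposition H π =
  ∀ u v → π u ≡ π v →
    Σ (Walk H u v) λ p → All (λ w → π w ≡ π u) (walkNodes p)

cutVec : ∀ {n m} → LiftedGraph n m → (Fin n → Fin n) → Fin m → ℚ
cutVec H π e with π (proj₁ (ends H e)) ≟ π (proj₂ (ends H e))
... | yes _ = 0ℚ
... | no  _ = 1ℚ

IsLiftedMulticut : ∀ {n m} → LiftedGraph n m → (Fin m → ℚ) → Set
IsLiftedMulticut {n} H x =
  ∃[ π ] (IsDecomposition H π × (∀ e → x e ≡ cutVec H π e))

Σ[<_]_ : (k : ℕ) → (Fin k → ℚ) → ℚ
Σ[< zero  ] f = 0ℚ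
Σ[< suc k ] f = f zero + Σ[< k ] (λ i → f (suc i))

AffIndep : ∀ {m} (k : ℕ) → (Fin k → Fin m → ℚ) → Set
AffIndep {m} k v =
  ∀ (λ′ : Fin k → ℚ) →
    Σ[< k ] λ′ ≡ 0ℚ →
    (∀ (c : Fin m) → Σ[< k ] (λ i → λ′ i * v i c) ≡ 0ℚ) →
    ∀ i → λ′ i ≡ 0ℚ

-- The set S ⊆ ℚ^m contains r affinely independent points but never r+1
-- (i.e. r is the maximum number of affinely independent points of S,
--  so dim conv(S) = r - 1, with dim ∅ = -1).
AffRank : ∀ {m} → ((Fin m → ℚ) → Set) → ℕ → Set
AffRank {m} S r =
  (Σ (Fin r → Fin m → ℚ) λ v → (∀ i → S (v i)) × AffIndep r v) ×
  (∀ (k : ℕ) (v : Fin k → Fin m → ℚ) → (∀ i → S (v i)) → AffIndep k v →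
     k Data.Nat.≤ r)

-- The valid inequality x_e ≤ 1 defines a facet of LMC(G,Ĝ) = conv(S):
-- the face conv(S) ∩ {x_e = 1} = conv{ x ∈ S | x_e = 1 } has dimension
-- dim LMC(G,Ĝ) - 1.
FacetXeLe1 : ∀ {n m} → LiftedGraph n m → Fin m → Set
FacetXeLe1 H e =
  ∃[ r ] (AffRank (IsLiftedMulticut H) (suc r) ×
          AffRank (λ x → IsLiftedMulticut H x × x e ≡ 1ℚ) r)

{-# OPTIONS --safe #-}
module Submission where

-- Full dimension: besides the vector cutting everything (all blocks singletons), every edge
-- f = uv gives the multicut whose only non-singleton block is the node set of a shortest
-- uv-walk.  That multicut leaves f uncut, and it leaves another edge f′ uncut only if both ends
-- of f′ lie on the walk, which then contains a strictly shorter walk for f′.  Ordered by these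
-- lengths the vectors form a unitriangular system, hence are affinely independent.
-- The face x_e = 1, e = st: the same construction over all f ≠ e, now with shortest walks
-- avoiding s or avoiding t, keeps e cut and gives one point fewer.  Such a walk exists unless
-- s and t are both uv-cut-nodes, which for f ∈ E forces f = e.  Conversely, if s and t are
-- uv-cut-nodes for some f = uv ≠ e, a block containing u and v contains a uv-path, hence s and
-- t; so every multicut cutting e also cuts f, and the face lies in x_e = x_f = 1, too small.

open import Defs
open import Level using (0ℓ)
open import Data.Nat as ℕ using (ℕ; zero; suc; _≤_; _<_; _∸_; _⊔_; z≤n; s≤s; _≤?_)
open import Data.Nat.Induction using (<-wellFounded)
import Data.Nat.Properties as ℕ
open import Data.Fin as Fin using (Fin; zero; suc; punchIn; punchOut)
open import Data.Fin.Properties using (any?; punchIn-punchOut)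
import Data.Fin.Properties as Fin
open import Data.Product using (Σ; ∃; ∃-syntax; ∃₂; _×_; _,_; proj₁; proj₂)
open import Data.Sum as Sum using (_⊎_; inj₁; inj₂; [_,_]′)
open import Data.Bool as Bool using (true; false)
open import Data.List as List using (List; []; _∷_)
open import Data.List.Relation.Unary.All as All using (All; []; _∷_)
open import Data.List.Relation.Unary.All.Properties using (¬Any⇒All¬; anti-mono)
open import Data.List.Relation.Unary.Any using (here; there)
open import Data.List.Relation.Unary.AllPairs using ([]; _∷_)
open import Data.List.Relation.Unary.Unique.Propositional using (Unique)
open import Data.List.Membership.Propositional using (_∈_)
open import Data.List.Membership.Propositional.Properties using (∈-lookup)
open import Data.List.Relation.Binary.Subset.Propositional using (_⊆_)
open import Data.Rational using (ℚ; 0ℚ; 1ℚ; _+_; _*_; -_; _-_; 1/_)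
import Data.Rational as ℚ
import Data.Rational.Properties as ℚ
open import Data.Rational.Solver using (module +-*-Solver)
open import Function using (_∘_; id)
open import Induction.WellFounded using (WfRec)
import Induction.WellFounded as WF
import Relation.Binary.Construct.On as On
open import Relation.Nullary using (¬_; Dec; yes; no; contradiction)
open import Relation.Nullary.Decidable using (¬?; decidable-stable; map′; _×-dec_; _⊎-dec_)
open import Relation.Unary using (Pred; Decidable)
open import Relation.Unary.Properties using (U?)
open import Function.Bundles using (_⇔_; mk⇔)
open import Relation.Binary.PropositionalEquality

open +-*-Solver using (solve; _:=_; _:+_; _:*_; :-_; con)

Σ-cong : ∀ k {f g : Fin k → ℚ} → (∀ i → f i ≡ g i) → Σ[< k ] f ≡ Σ[< k ] g
Σ-cong zero    f≗g = refl
Σ-cong (suc k) f≗g = cong₂ _+_ (f≗g zero) (Σ-cong k (f≗g ∘ suc))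

Σ-distrib-+ : ∀ k (f g : Fin k → ℚ) → Σ[< k ] (λ i → f i + g i) ≡ Σ[< k ] f + Σ[< k ] g
Σ-distrib-+ zero    f g = refl
Σ-distrib-+ (suc k) f g =
  trans (cong (f zero + g zero +_) (Σ-distrib-+ k (f ∘ suc) (g ∘ suc)))
        (solve 4 (λ x y X Y → (x :+ y) :+ (X :+ Y) := (x :+ X) :+ (y :+ Y))
               refl (f zero) (g zero) (Σ[< k ] (f ∘ suc)) (Σ[< k ] (g ∘ suc)))

*-distribˡ-Σ : ∀ k a (f : Fin k → ℚ) → a * Σ[< k ] f ≡ Σ[< k ] (λ i → a * f i)
*-distribˡ-Σ zero    a f = ℚ.*-zeroʳ a
*-distribˡ-Σ (suc k) a f =
  trans (ℚ.*-distribˡ-+ a (f zero) _) (cong (a * f zero +_) (*-distribˡ-Σ k a (f ∘ suc)))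

Σ-zero : ∀ k (f : Fin k → ℚ) → (∀ i → f i ≡ 0ℚ) → Σ[< k ] f ≡ 0ℚ
Σ-zero zero    f f≡0 = refl
Σ-zero (suc k) f f≡0 = cong₂ _+_ (f≡0 zero) (Σ-zero k (f ∘ suc) (f≡0 ∘ suc))

Σ-single : ∀ k (f : Fin k → ℚ) c → (∀ i → i ≢ c → f i ≡ 0ℚ) → Σ[< k ] f ≡ f c
Σ-single (suc k) f zero    f≡0 =
  trans (cong (f zero +_) (Σ-zero k (f ∘ suc) (λ i → f≡0 (suc i) λ ())))
        (ℚ.+-identityʳ (f zero))
Σ-single (suc k) f (suc c) f≡0 =
  trans (cong₂ _+_ (f≡0 zero λ ())
                   (Σ-single k (f ∘ suc) c (λ i i≢c → f≡0 (suc i) (i≢c ∘ Fin.suc-injective))))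
        (ℚ.+-identityˡ (f (suc c)))

p≢0∧q≢0⇒p*q≢0 : ∀ {p q} → p ≢ 0ℚ → q ≢ 0ℚ → p * q ≢ 0ℚ
p≢0∧q≢0⇒p*q≢0 {p} {q} p≢0 q≢0 pq≡0 = q≢0 (begin
    q                ≡⟨ sym (ℚ.*-identityˡ q) ⟩
    1ℚ * q           ≡⟨ cong (_* q) (sym (ℚ.*-inverseˡ p)) ⟩
    (1/ p * p) * q   ≡⟨ ℚ.*-assoc (1/ p) p q ⟩
    1/ p * (p * q)   ≡⟨ cong (1/ p *_) pq≡0 ⟩
    1/ p * 0ℚ        ≡⟨ ℚ.*-zeroʳ (1/ p) ⟩
    0ℚ               ∎)
  where
  open ≡-Reasoning
  instance _ = ℚ.≢-nonZero p≢0

Nontrivial : ∀ {k} → (Fin k → ℚ) → Set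
Nontrivial l = ∃ λ i → l i ≢ 0ℚ

InKernel : ∀ {m k} → (Fin m → Fin k → ℚ) → (Fin k → ℚ) → Set
InKernel {k = k} A l = ∀ r → Σ[< k ] (λ i → l i * A r i) ≡ 0ℚ

-- Row c of A with the first column cleared by the pivot row r, scaled by the pivot to avoid division.
eliminate : ∀ {m k} → (Fin (suc m) → Fin (suc k) → ℚ) → Fin (suc m) → Fin m → Fin k → ℚ
eliminate A r c i = A r zero * A (punchIn r c) (suc i) + (- A (punchIn r c) zero) * A r (suc i)

extend-kernel : ∀ {m k} (A : Fin (suc m) → Fin (suc k) → ℚ) r → A r zero ≢ 0ℚ →
                (μ : Fin k → ℚ) → Nontrivial μ → InKernel (eliminate A r) μ →
                ∃ λ l → Nontrivial l × InKernel A l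
extend-kernel {k = k} A r a≢0 μ (j , μⱼ≢0) μ∈ker = l , (suc j , p≢0∧q≢0⇒p*q≢0 a≢0 μⱼ≢0) , l∈ker
  where
  open ≡-Reasoning
  a = A r zero
  T : Fin _ → ℚ
  T q = Σ[< k ] (λ i → μ i * A q (suc i))
  l : Fin (suc k) → ℚ
  l zero    = - T r
  l (suc i) = a * μ i
  row : ∀ q → Σ[< suc k ] (λ i → l i * A q i) ≡ - T r * A q zero + a * T q
  row q = cong (- T r * A q zero +_) (begin
    Σ[< k ] (λ i → (a * μ i) * A q (suc i)) ≡⟨ Σ-cong k (λ i → ℚ.*-assoc a (μ i) _) ⟩
    Σ[< k ] (λ i → a * (μ i * A q (suc i))) ≡⟨ *-distribˡ-Σ k a _ ⟨
    a * T q                                 ∎)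
  eliminated : ∀ c → a * T (punchIn r c) + (- A (punchIn r c) zero) * T r ≡ 0ℚ
  eliminated c = begin
      a * T q + (- x) * T r
    ≡⟨ cong₂ _+_ (*-distribˡ-Σ k a _) (*-distribˡ-Σ k (- x) _) ⟩
      Σ[< k ] (λ i → a * (μ i * A q (suc i))) + Σ[< k ] (λ i → (- x) * (μ i * A r (suc i)))
    ≡⟨ Σ-distrib-+ k _ _ ⟨
      Σ[< k ] (λ i → a * (μ i * A q (suc i)) + (- x) * (μ i * A r (suc i)))
    ≡⟨ Σ-cong k (λ i → solve 5 (λ a x μ y z → a :* (μ :* y) :+ (:- x) :* (μ :* z)
                                              := μ :* (a :* y :+ (:- x) :* z))
                                refl a x (μ i) (A q (suc i)) (A r (suc i))) ⟩
      Σ[< k ] (λ i → μ i * eliminate A r c i)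
    ≡⟨ μ∈ker c ⟩
      0ℚ
    ∎
    where
    q = punchIn r c
    x = A q zero
  l∈ker : InKernel A l
  l∈ker q with r Fin.≟ q
  ... | yes refl = trans (row r) (solve 2 (λ t a → (:- t) :* a :+ a :* t := con 0ℚ) refl (T r) a)
  ... | no  r≢q  = trans (row q) (begin
      - T r * A q zero + a * T q
    ≡⟨ solve 4 (λ t x a u → (:- t) :* x :+ a :* u := a :* u :+ (:- x) :* t)
               refl (T r) (A q zero) a (T q) ⟩
      a * T q + (- A q zero) * T r
    ≡⟨ subst (λ q → a * T q + (- A q zero) * T r ≡ 0ℚ) (punchIn-punchOut r≢q)
             (eliminated (punchOut r≢q)) ⟩
      0ℚ
    ∎)

nontrivial-kernel : ∀ {m k} → m < k → (A : Fin m → Fin k → ℚ) →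
                    ∃ λ l → Nontrivial l × InKernel A l
nontrivial-kernel {m} {suc k} m<k A with any? (λ r → ¬? (A r zero ℚ.≟ 0ℚ))
... | no no-pivot = l , (zero , ℚ.1≢0) , l∈ker
  where
  l : Fin (suc k) → ℚ
  l zero    = 1ℚ
  l (suc _) = 0ℚ
  l∈ker : InKernel A l
  l∈ker r = cong₂ _+_
    (trans (ℚ.*-identityˡ (A r zero)) (decidable-stable (A r zero ℚ.≟ 0ℚ) (no-pivot ∘ (r ,_))))
    (Σ-zero k _ (λ i → ℚ.*-zeroˡ (A r (suc i))))
nontrivial-kernel {suc m} {suc k} (s≤s m<k) A | yes (r , pivot) =
  let μ , μ-nontrivial , μ∈ker = nontrivial-kernel m<k (eliminate A r)
  in  extend-kernel A r pivot μ μ-nontrivial μ∈ker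

affIndep-≤ : ∀ {m k} (v : Fin k → Fin m → ℚ) → AffIndep k v → k ≤ suc m
affIndep-≤ {m} {k} v indep with k ≤? suc m
... | yes k≤1+m = k≤1+m
... | no  k≰1+m =
  let l , (i , lᵢ≢0) , l∈ker = nontrivial-kernel (ℕ.≰⇒> k≰1+m) A
      Σl≡0 = trans (Σ-cong k (λ i → sym (ℚ.*-identityʳ (l i)))) (l∈ker zero)
  in  contradiction (indep l Σl≡0 (l∈ker ∘ suc) i) lᵢ≢0
  where
  A : Fin (suc m) → Fin k → ℚ
  A zero    _ = 1ℚ
  A (suc c) i = v i c

affIndep-dropConstant : ∀ {m k} (v : Fin k → Fin (suc m) → ℚ) e → (∀ i → v i e ≡ 1ℚ) →
                        AffIndep k v → AffIndep k (λ i → v i ∘ punchIn e)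
affIndep-dropConstant {k = k} v e constant indep l Σl≡0 l∈ker = indep l Σl≡0 coordinate
  where
  coordinate : ∀ c → Σ[< k ] (λ i → l i * v i c) ≡ 0ℚ
  coordinate c with e Fin.≟ c
  ... | yes refl = trans (Σ-cong k (λ i → trans (cong (l i *_) (constant i)) (ℚ.*-identityʳ (l i)))) Σl≡0
  ... | no  e≢c  = subst (λ c → Σ[< k ] (λ i → l i * v i c) ≡ 0ℚ) (punchIn-punchOut e≢c)
                         (l∈ker (punchOut e≢c))

affIndep-≤-constant : ∀ {m k} (v : Fin k → Fin (suc m) → ℚ) {e} → (∀ i → v i e ≡ 1ℚ) →
                      AffIndep k v → k ≤ suc m
affIndep-≤-constant v {e} e-constant indep = affIndep-≤ _ (affIndep-dropConstant v e e-constant indep)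

affIndep-≤-twoConstants : ∀ {m k} (v : Fin k → Fin (suc m) → ℚ) {e f} → e ≢ f →
                          (∀ i → v i e ≡ 1ℚ) → (∀ i → v i f ≡ 1ℚ) → AffIndep k v → k ≤ m
affIndep-≤-twoConstants {zero}  v {zero} {zero} 0≢0 _ _ _ = contradiction refl 0≢0
affIndep-≤-twoConstants {suc m} v {e} {f} e≢f e-constant f-constant indep =
  affIndep-≤-constant _ f′-constant (affIndep-dropConstant v e e-constant indep)
  where
  f′-constant : ∀ i → v i (punchIn e (punchOut e≢f)) ≡ 1ℚ
  f′-constant i = subst (λ c → v i c ≡ 1ℚ) (sym (punchIn-punchOut e≢f)) (f-constant i)

upper-bound : ∀ {k} (d : Fin k → ℕ) → ∃ λ N → ∀ i → d i ≤ N
upper-bound {zero}  d = 0 , λ ()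
upper-bound {suc k} d =
  let N , d≤N = upper-bound (d ∘ suc)
  in  d zero ⊔ N , λ { zero    → ℕ.m≤m⊔n (d zero) N
                     ; (suc i) → ℕ.≤-trans (d≤N i) (ℕ.m≤n⊔m (d zero) N) }

-- Off-diagonal entries point upwards in d, so the induction runs downwards: on N ∸ d.
triangular-kernel : ∀ {k} (w : Fin k → Fin k → ℚ) (d : Fin k → ℕ) →
                    (∀ c → w c c ≡ 1ℚ) → (∀ i c → i ≢ c → w i c ≢ 0ℚ → d c < d i) →
                    (l : Fin k → ℚ) → (∀ c → Σ[< k ] (λ i → l i * w i c) ≡ 0ℚ) →
                    ∀ i → l i ≡ 0ℚ
triangular-kernel {k} w d diagonal triangular l l∈ker =
  WF.All.wfRec (On.wellFounded height <-wellFounded) 0ℓ (λ i → l i ≡ 0ℚ) vanishes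
  where
  N = proj₁ (upper-bound d)
  height : Fin k → ℕ
  height i = N ∸ d i
  vanishes : ∀ c → WfRec (λ i i′ → height i < height i′) (λ i → l i ≡ 0ℚ) c → l c ≡ 0ℚ
  vanishes c higher-vanish = begin
      l c                          ≡⟨ ℚ.*-identityʳ (l c) ⟨
      l c * 1ℚ                     ≡⟨ cong (l c *_) (diagonal c) ⟨
      l c * w c c                  ≡⟨ Σ-single k (λ i → l i * w i c) c off-diagonal ⟨
      Σ[< k ] (λ i → l i * w i c)  ≡⟨ l∈ker c ⟩
      0ℚ                           ∎
    where
    open ≡-Reasoning
    off-diagonal : ∀ i → i ≢ c → l i * w i c ≡ 0ℚ
    off-diagonal i i≢c with w i c ℚ.≟ 0ℚ
    ... | yes w≡0 = trans (cong (l i *_) w≡0) (ℚ.*-zeroʳ (l i))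
    ... | no  w≢0 =
      let lᵢ≡0 = higher-vanish (ℕ.∸-monoʳ-< (triangular i c i≢c w≢0) (proj₂ (upper-bound d) i))
      in  trans (cong (_* w i c) lᵢ≡0) (ℚ.*-zeroˡ (w i c))

affIndep-triangular : ∀ {m j} (v : Fin (suc j) → Fin m → ℚ) (g : Fin j → Fin m) (d : Fin j → ℕ) →
                      (∀ c → v zero (g c) ≡ 1ℚ) → (∀ c → v (suc c) (g c) ≡ 0ℚ) →
                      (∀ c′ c → c′ ≢ c → v (suc c′) (g c) ≢ 1ℚ → d c < d c′) →
                      AffIndep (suc j) v
affIndep-triangular {j = j} v g d base diagonal triangular l Σl≡0 l∈ker =
  triangular-kernel w d′ w-diagonal w-triangular l w-kernel
  where
  -- column 0 is the affine relation Σ l ≡ 0; column suc c is Σ l minus coordinate g c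
  w : Fin (suc j) → Fin (suc j) → ℚ
  w i zero    = 1ℚ
  w i (suc c) = 1ℚ - v i (g c)
  d′ : Fin (suc j) → ℕ
  d′ zero    = 0
  d′ (suc c) = suc (d c)
  w-diagonal : ∀ c → w c c ≡ 1ℚ
  w-diagonal zero    = refl
  w-diagonal (suc c) = cong (λ x → 1ℚ - x) (diagonal c)
  w-triangular : ∀ i c → i ≢ c → w i c ≢ 0ℚ → d′ c < d′ i
  w-triangular zero     zero    0≢0  _   = contradiction refl 0≢0
  w-triangular (suc c′) zero    _    _   = s≤s z≤n
  w-triangular zero     (suc c) _    w≢0 = contradiction (cong (λ x → 1ℚ - x) (base c)) w≢0
  w-triangular (suc c′) (suc c) c′≢c w≢0 =
    s≤s (triangular c′ c (c′≢c ∘ cong suc) (w≢0 ∘ cong (λ x → 1ℚ - x)))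
  w-kernel : ∀ c → Σ[< suc j ] (λ i → l i * w i c) ≡ 0ℚ
  w-kernel zero    = trans (Σ-cong (suc j) (λ i → ℚ.*-identityʳ (l i))) Σl≡0
  w-kernel (suc c) = begin
      Σ[< suc j ] (λ i → l i * (1ℚ - v i (g c)))
    ≡⟨ Σ-cong (suc j) (λ i → solve 2 (λ l x → l :* (con 1ℚ :+ (:- x))
                                              := l :+ con (- 1ℚ) :* (l :* x))
                                     refl (l i) (v i (g c))) ⟩
      Σ[< suc j ] (λ i → l i + - 1ℚ * (l i * v i (g c)))
    ≡⟨ Σ-distrib-+ (suc j) l (λ i → - 1ℚ * (l i * v i (g c))) ⟩
      Σ[< suc j ] l + Σ[< suc j ] (λ i → - 1ℚ * (l i * v i (g c)))
    ≡⟨ cong₂ _+_ Σl≡0 (trans (sym (*-distribˡ-Σ (suc j) (- 1ℚ) (λ i → l i * v i (g c))))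
                             (cong (- 1ℚ *_) (l∈ker (g c)))) ⟩
      0ℚ + - 1ℚ * 0ℚ
    ≡⟨⟩
      0ℚ
    ∎
    where open ≡-Reasoning

Least : Pred ℕ 0ℓ → ℕ → Set
Least P m = P m × (∀ {k} → P k → m ≤ k)

least-or-absent : ∀ {P} → Decidable P → ∀ b → (∃ (Least P)) ⊎ (∀ {k} → k < b → ¬ P k)
least-or-absent P? zero = inj₂ λ ()
least-or-absent P? (suc b) with least-or-absent P? b
... | inj₁ least  = inj₁ least
... | inj₂ absent with P? b
...   | yes Pb  = inj₁ (b , Pb , λ Pk → ℕ.≮⇒≥ (λ k<b → absent k<b Pk))
...   | no  ¬Pb = inj₂ λ k<1+b →
  [ (λ k<b → absent k<b) , (λ { refl → ¬Pb }) ]′ (ℕ.m<1+n⇒m<n∨m≡n k<1+b)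

least : ∀ {P} → Decidable P → ∀ {n} → P n → ∃ (Least P)
least P? {n} Pn = [ id , (λ absent → contradiction Pn (absent (ℕ.n<1+n n))) ]′ (least-or-absent P? (suc n))

lookup-injective : ∀ {A : Set} {xs : List A} → Unique xs →
                   ∀ i j → List.lookup xs i ≡ List.lookup xs j → i ≡ j
lookup-injective (_    ∷ _)   zero    zero    _  = refl
lookup-injective (x∉xs ∷ _)   zero    (suc j) eq = contradiction eq (All.lookup x∉xs (∈-lookup j))
lookup-injective (x∉xs ∷ _)   (suc i) zero    eq = contradiction (sym eq) (All.lookup x∉xs (∈-lookup i))
lookup-injective (_    ∷ xs!) (suc i) (suc j) eq = cong suc (lookup-injective xs! i j eq)

Unique⇒length≤ : ∀ {n} (xs : List (Fin n)) → Unique xs → List.length xs ≤ n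
Unique⇒length≤ {n} xs xs! with List.length xs ≤? n
... | yes length≤n = length≤n
... | no  length≰n =
  let i , j , i<j , eq = Fin.pigeonhole (ℕ.≰⇒> length≰n) (List.lookup xs)
  in  contradiction (lookup-injective xs! i j eq) (Fin.<⇒≢ i<j)

end₁ end₂ : ∀ {n m} → LiftedGraph n m → Fin m → Fin n
end₁ H e = proj₁ (ends H e)
end₂ H e = proj₂ (ends H e)

module Walks {n m} (H : LiftedGraph n m) where

  open import Data.List.Membership.DecPropositional (Fin._≟_ {n}) using (_∈?_)

  private
    variable
      a b c d u v w x y : Fin n

  walkLength : Walk H u v → ℕ
  walkLength here       = 0
  walkLength (step _ p) = suc (walkLength p)

  AdjG-sym : AdjG H u w → AdjG H w u
  AdjG-sym (e , e∈E , inj₁ (u≡ , w≡)) = e , e∈E , inj₂ (u≡ , w≡)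
  AdjG-sym (e , e∈E , inj₂ (u≡ , w≡)) = e , e∈E , inj₁ (u≡ , w≡)

  infixr 5 _++ʷ_
  _++ʷ_ : Walk H u w → Walk H w v → Walk H u v
  here       ++ʷ q = q
  step u~ p ++ʷ q = step u~ (p ++ʷ q)

  reverseʷ : Walk H u v → Walk H v u
  reverseʷ here        = here
  reverseʷ (step u~ p) = reverseʷ p ++ʷ step (AdjG-sym u~) here

  walkLength-++ : (p : Walk H u w) (q : Walk H w v) →
                  walkLength (p ++ʷ q) ≡ walkLength p ℕ.+ walkLength q
  walkLength-++ here       q = refl
  walkLength-++ (step _ p) q = cong suc (walkLength-++ p q)

  walkLength-reverse : (p : Walk H u v) → walkLength (reverseʷ p) ≡ walkLength p
  walkLength-reverse here        = refl
  walkLength-reverse (step u~ p) = begin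
    walkLength (reverseʷ p ++ʷ step (AdjG-sym u~) here) ≡⟨ walkLength-++ (reverseʷ p) _ ⟩
    walkLength (reverseʷ p) ℕ.+ 1                        ≡⟨ cong (ℕ._+ 1) (walkLength-reverse p) ⟩
    walkLength p ℕ.+ 1                                   ≡⟨ ℕ.+-comm (walkLength p) 1 ⟩
    suc (walkLength p)                                   ∎
    where open ≡-Reasoning

  start∈ : (p : Walk H u v) → u ∈ walkNodes p
  start∈ here       = here refl
  start∈ (step _ _) = here refl

  end∈ : (p : Walk H u v) → v ∈ walkNodes p
  end∈ here       = here refl
  end∈ (step _ p) = there (end∈ p)

  ∈-++⁻ : (p : Walk H u w) (q : Walk H w v) →
          x ∈ walkNodes (p ++ʷ q) → x ∈ walkNodes p ⊎ x ∈ walkNodes q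
  ∈-++⁻ here       q x∈q         = inj₂ x∈q
  ∈-++⁻ (step _ p) q (here x≡u)  = inj₁ (here x≡u)
  ∈-++⁻ (step _ p) q (there x∈) = Sum.map₁ there (∈-++⁻ p q x∈)

  ⊆-++ˡ : (p : Walk H u w) (q : Walk H w v) → walkNodes p ⊆ walkNodes (p ++ʷ q)
  ⊆-++ˡ here       q (here refl)  = start∈ q
  ⊆-++ˡ (step _ p) q (here x≡u)   = here x≡u
  ⊆-++ˡ (step _ p) q (there x∈p) = there (⊆-++ˡ p q x∈p)

  ⊆-++ʳ : (p : Walk H u w) (q : Walk H w v) → walkNodes q ⊆ walkNodes (p ++ʷ q)
  ⊆-++ʳ here       q x∈q = x∈q
  ⊆-++ʳ (step _ p) q x∈q = there (⊆-++ʳ p q x∈q)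

  reverse-⊆ : (p : Walk H u v) → walkNodes (reverseʷ p) ⊆ walkNodes p
  reverse-⊆ here        x∈ = x∈
  reverse-⊆ (step u~ p) x∈ with ∈-++⁻ (reverseʷ p) (step (AdjG-sym u~) here) x∈
  ... | inj₁ x∈p                = there (reverse-⊆ p x∈p)
  ... | inj₂ (here refl)         = there (start∈ p)
  ... | inj₂ (there (here refl)) = here refl

  splitAt : (p : Walk H u v) → x ∈ walkNodes p →
            ∃₂ λ (q : Walk H u x) (r : Walk H x v) → q ++ʷ r ≡ p
  splitAt here        (here refl)  = here , here , refl
  splitAt (step u~ p) (here refl)  = here , step u~ p , refl
  splitAt (step u~ p) (there x∈p) with splitAt p x∈p
  ... | q , r , refl = step u~ q , r , refl

  infix-shorter : (p : Walk H a c) (q : Walk H c d) (r : Walk H d b) →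
                  walkLength q < walkLength p ℕ.+ walkLength q ℕ.+ walkLength r ⊎ (a ≡ c × d ≡ b)
  infix-shorter here       q here       = inj₂ (refl , refl)
  infix-shorter here       q (step _ r) = inj₁ (ℕ.m<m+n (walkLength q) ℕ.z<s)
  infix-shorter (step _ p) q r          =
    inj₁ (s≤s (ℕ.≤-trans (ℕ.m≤n+m (walkLength q) (walkLength p)) (ℕ.m≤m+n _ (walkLength r))))

  Subwalk : Walk H a b → Fin n → Fin n → Set
  Subwalk {a} {b} p c d = ∃ λ (q : Walk H c d) →
    walkNodes q ⊆ walkNodes p × (walkLength q < walkLength p ⊎ SamePair (c , d) (a , b))

  subwalk : (p : Walk H a b) → c ∈ walkNodes p → d ∈ walkNodes p → Subwalk p c d
  subwalk {c = c} {d} p c∈p d∈p with splitAt p c∈p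
  ... | p₁ , p₂ , refl = [ backward , forward ]′ (∈-++⁻ p₁ p₂ d∈p)
    where
    forward : d ∈ walkNodes p₂ → Subwalk (p₁ ++ʷ p₂) c d
    forward d∈p₂ with splitAt p₂ d∈p₂
    ... | p₃ , p₄ , refl =
      p₃ , (λ x∈ → ⊆-++ʳ p₁ _ (⊆-++ˡ p₃ p₄ x∈)) ,
      Sum.map (subst (walkLength p₃ <_) (sym whole)) (λ (a≡c , d≡b) → inj₁ (sym a≡c , d≡b))
              (infix-shorter p₁ p₃ p₄)
      where
      whole : walkLength (p₁ ++ʷ p₃ ++ʷ p₄) ≡ walkLength p₁ ℕ.+ walkLength p₃ ℕ.+ walkLength p₄
      whole = begin
        walkLength (p₁ ++ʷ p₃ ++ʷ p₄)
          ≡⟨ walkLength-++ p₁ _ ⟩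
        walkLength p₁ ℕ.+ walkLength (p₃ ++ʷ p₄)
          ≡⟨ cong (walkLength p₁ ℕ.+_) (walkLength-++ p₃ p₄) ⟩
        walkLength p₁ ℕ.+ (walkLength p₃ ℕ.+ walkLength p₄)
          ≡⟨ ℕ.+-assoc (walkLength p₁) _ _ ⟨
        walkLength p₁ ℕ.+ walkLength p₃ ℕ.+ walkLength p₄
          ∎
        where open ≡-Reasoning
    backward : d ∈ walkNodes p₁ → Subwalk (p₁ ++ʷ p₂) c d
    backward d∈p₁ with splitAt p₁ d∈p₁
    ... | p₃ , p₄ , refl =
      reverseʷ p₄ , (λ x∈ → ⊆-++ˡ (p₃ ++ʷ p₄) p₂ (⊆-++ʳ p₃ p₄ (reverse-⊆ p₄ x∈))) ,
      Sum.map (subst₂ _<_ (sym (walkLength-reverse p₄)) (sym whole))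
              (λ (a≡d , c≡b) → inj₂ (c≡b , sym a≡d))
              (infix-shorter p₃ p₄ p₂)
      where
      whole : walkLength ((p₃ ++ʷ p₄) ++ʷ p₂) ≡
              walkLength p₃ ℕ.+ walkLength p₄ ℕ.+ walkLength p₂
      whole = trans (walkLength-++ (p₃ ++ʷ p₄) p₂) (cong (ℕ._+ walkLength p₂) (walkLength-++ p₃ p₄))

  ++-isPathʳ : (p : Walk H u w) (q : Walk H w v) → IsPath (p ++ʷ q) → IsPath q
  ++-isPathʳ here       q q!       = q!
  ++-isPathʳ (step _ p) q (_ ∷ pq!) = ++-isPathʳ p q pq!

  toPath : (p : Walk H u v) → ∃ λ (q : Walk H u v) → IsPath q × walkNodes q ⊆ walkNodes p
  toPath here = here , [] ∷ [] , id
  toPath {u} (step u~ p) with toPath p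
  ... | q , q! , q⊆p with u ∈? walkNodes q
  ...   | no u∉q = step u~ q , ¬Any⇒All¬ (walkNodes q) u∉q ∷ q! ,
                   λ { (here x≡u) → here x≡u ; (there x∈q) → there (q⊆p x∈q) }
  ...   | yes u∈q with splitAt q u∈q
  ...     | q₁ , q₂ , refl = q₂ , ++-isPathʳ q₁ q₂ q! , λ x∈ → there (q⊆p (⊆-++ʳ q₁ q₂ x∈))

  length-walkNodes : (p : Walk H u v) → List.length (walkNodes p) ≡ suc (walkLength p)
  length-walkNodes here       = refl
  length-walkNodes (step _ p) = cong suc (length-walkNodes p)

  path-walkLength< : (p : Walk H u v) → IsPath p → walkLength p < n
  path-walkLength< p p! = subst (_≤ n) (length-walkNodes p) (Unique⇒length≤ (walkNodes p) p!)

  block-path : ∀ {π} → IsDecomposition H π → π u ≡ π v →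
               ∃ λ (q : Walk H u v) → IsPath q × All (λ x → π x ≡ π u) (walkNodes q)
  block-path {u} {v} π-decomposition same =
    let p , p-in-block = π-decomposition u v same
        q , q! , q⊆p   = toPath p
    in  q , q! , anti-mono q⊆p p-in-block

  samePair? : (p q : Fin n × Fin n) → Dec (SamePair p q)
  samePair? (a , b) (c , d) = ((a Fin.≟ c) ×-dec (b Fin.≟ d)) ⊎-dec ((a Fin.≟ d) ×-dec (b Fin.≟ c))

  adj? : ∀ u w → Dec (AdjG H u w)
  adj? u w = any? (λ e → (inE H e Bool.≟ true) ×-dec samePair? (ends H e) (u , w))

  WalkWithin : Pred (Fin n) 0ℓ → ℕ → Fin n → Fin n → Set
  WalkWithin P ℓ a b = Σ (Walk H a b) λ p → walkLength p ≡ ℓ × All P (walkNodes p)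

  walkWithin? : ∀ {P} → Decidable P → ∀ ℓ a b → Dec (WalkWithin P ℓ a b)
  walkWithin? P? zero a b =
    map′ (λ { (refl , Pa) → here , refl , Pa ∷ [] })
         (λ { (here , _ , Pa ∷ []) → refl , Pa ; (step _ _ , () , _) })
         ((a Fin.≟ b) ×-dec P? a)
  walkWithin? P? (suc ℓ) a b =
    map′ (λ { (Pa , _ , a~w , p , refl , Pp) → step a~w p , refl , Pa ∷ Pp })
         (λ { (here , () , _) ; (step a~w p , refl , Pa ∷ Pp) → Pa , _ , a~w , p , refl , Pp })
         (P? a ×-dec any? (λ w → adj? a w ×-dec walkWithin? P? ℓ w b))

  Reachable : Pred (Fin n) 0ℓ → Fin n → Fin n → Set
  Reachable P a b = ∃ λ ℓ → WalkWithin P ℓ a b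

  reachable? : ∀ {P} → Decidable P → ∀ a b → Dec (Reachable P a b)
  reachable? {P} P? a b =
    map′ (λ (i , walk) → Fin.toℕ i , walk) viaPath (any? (λ i → walkWithin? P? (Fin.toℕ i) a b))
    where
    viaPath : Reachable P a b → ∃ λ (i : Fin n) → WalkWithin P (Fin.toℕ i) a b
    viaPath (_ , p , _ , Pp) =
      let q , q! , q⊆p = toPath p
      in  Fin.fromℕ< (path-walkLength< q q!) , q , sym (Fin.toℕ-fromℕ< _) , anti-mono q⊆p Pp

  unreachable⇒cutNode : ¬ Reachable (x ≢_) a b → CutNode H a b x
  unreachable⇒cutNode {x} unreachable p _ with x ∈? walkNodes p
  ... | yes x∈p = x∈p
  ... | no  x∉p = contradiction (_ , p , refl , ¬Any⇒All¬ (walkNodes p) x∉p) unreachable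

  walkPartition : Walk H u v → Fin n → Fin n
  walkPartition {u} p x with x ∈? walkNodes p
  ... | yes _ = u
  ... | no  _ = x

  walkPartition-∈ : (p : Walk H u v) → x ∈ walkNodes p → walkPartition p x ≡ u
  walkPartition-∈ {x = x} p x∈p with x ∈? walkNodes p
  ... | yes _   = refl
  ... | no  x∉p = contradiction x∈p x∉p

  walkPartition-merges : (p : Walk H u v) → x ≢ y → walkPartition p x ≡ walkPartition p y →
                         x ∈ walkNodes p × y ∈ walkNodes p
  walkPartition-merges {x = x} {y = y} p x≢y eq with x ∈? walkNodes p | y ∈? walkNodes p
  ... | yes x∈p | yes y∈p = x∈p , y∈p
  ... | yes _   | no  y∉p = contradiction (subst (_∈ walkNodes p) eq (start∈ p)) y∉p
  ... | no  x∉p | yes _   = contradiction (subst (_∈ walkNodes p) (sym eq) (start∈ p)) x∉p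
  ... | no  _   | no  _   = contradiction eq x≢y

  walkPartition-decomposition : (p : Walk H u v) → IsDecomposition H (walkPartition p)
  walkPartition-decomposition p x y eq with x Fin.≟ y
  ... | yes refl = here , refl ∷ []
  ... | no  x≢y  =
    let x∈p , y∈p   = walkPartition-merges p x≢y eq
        q , q⊆p , _ = subwalk p x∈p y∈p
    in  q , All.tabulate (λ w∈q → trans (walkPartition-∈ p (q⊆p w∈q)) (sym (walkPartition-∈ p x∈p)))

module _ {n m} (H : LiftedGraph n m) (π : Fin n → Fin n) (e : Fin m) where

  cutVec-uncut : π (end₁ H e) ≡ π (end₂ H e) → cutVec H π e ≡ 0ℚ
  cutVec-uncut same with π (proj₁ (ends H e)) Fin.≟ π (proj₂ (ends H e))
  ... | yes _        = refl
  ... | no different = contradiction same different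

  cutVec-cut : π (end₁ H e) ≢ π (end₂ H e) → cutVec H π e ≡ 1ℚ
  cutVec-cut different with π (proj₁ (ends H e)) Fin.≟ π (proj₂ (ends H e))
  ... | yes same = contradiction same different
  ... | no  _    = refl

  cutVec≢1⇒uncut : cutVec H π e ≢ 1ℚ → π (end₁ H e) ≡ π (end₂ H e)
  cutVec≢1⇒uncut uncut with π (proj₁ (ends H e)) Fin.≟ π (proj₂ (ends H e))
  ... | yes same = same
  ... | no  _    = contradiction refl uncut

id-decomposition : ∀ {n m} (H : LiftedGraph n m) → IsDecomposition H id
id-decomposition H x .x refl = here , refl ∷ []

module ShortestWalks {n m} (H : LiftedGraph n m)
                     {P Q : Pred (Fin n) 0ℓ} (P? : Decidable P) (Q? : Decidable Q) where

  open Walks H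

  WithinPorQ : ∀ {a b} → Walk H a b → Set
  WithinPorQ p = All P (walkNodes p) ⊎ All Q (walkNodes p)

  Admissible : ℕ → Fin n → Fin n → Set
  Admissible ℓ a b = Σ (Walk H a b) λ p → walkLength p ≡ ℓ × WithinPorQ p

  admissible? : ∀ ℓ a b → Dec (Admissible ℓ a b)
  admissible? ℓ a b =
    map′ [ (λ (p , ∣p∣ , Pp) → p , ∣p∣ , inj₁ Pp) , (λ (p , ∣p∣ , Qp) → p , ∣p∣ , inj₂ Qp) ]′
         (λ { (p , ∣p∣ , inj₁ Pp) → inj₁ (p , ∣p∣ , Pp)
            ; (p , ∣p∣ , inj₂ Qp) → inj₂ (p , ∣p∣ , Qp) })
         (walkWithin? P? ℓ a b ⊎-dec walkWithin? Q? ℓ a b)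

  WithinPorQ-⊆ : ∀ {a b c d} {p : Walk H a b} {q : Walk H c d} →
                 walkNodes q ⊆ walkNodes p → WithinPorQ p → WithinPorQ q
  WithinPorQ-⊆ q⊆p = Sum.map (anti-mono q⊆p) (anti-mono q⊆p)

  module Family (simple : Simple H)
                {j} (g : Fin j → Fin m) (g-injective : ∀ {c c′} → g c ≡ g c′ → c ≡ c′)
                (connected : ∀ c → ∃ λ ℓ → Admissible ℓ (end₁ H (g c)) (end₂ H (g c))) where

    shortest : ∀ c → ∃ (Least (λ ℓ → Admissible ℓ (end₁ H (g c)) (end₂ H (g c))))
    shortest c = least (λ ℓ → admissible? ℓ _ _) (proj₂ (connected c))

    distance : Fin j → ℕ
    distance c = proj₁ (shortest c)

    geodesic : ∀ c → Walk H (end₁ H (g c)) (end₂ H (g c))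
    geodesic c = proj₁ (proj₁ (proj₂ (shortest c)))

    geodesic-length : ∀ c → walkLength (geodesic c) ≡ distance c
    geodesic-length c = proj₁ (proj₂ (proj₁ (proj₂ (shortest c))))

    geodesic-within : ∀ c → WithinPorQ (geodesic c)
    geodesic-within c = proj₂ (proj₂ (proj₁ (proj₂ (shortest c))))

    distance-minimal : ∀ c (q : Walk H (end₁ H (g c)) (end₂ H (g c))) → WithinPorQ q →
                       distance c ≤ walkLength q
    distance-minimal c q within = proj₂ (proj₂ (shortest c)) (q , refl , within)

    point : Fin (suc j) → Fin m → ℚ
    point zero    = cutVec H id
    point (suc c) = cutVec H (walkPartition (geodesic c))

    point-multicut : ∀ i → IsLiftedMulticut H (point i)
    point-multicut zero    = id , id-decomposition H , λ _ → refl
    point-multicut (suc c) = walkPartition (geodesic c) , walkPartition-decomposition (geodesic c) , λ _ → refl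

    identity-cuts : ∀ f → cutVec H id f ≡ 1ℚ
    identity-cuts f = cutVec-cut H id f (proj₁ simple f)

    geodesic-uncut : ∀ c → point (suc c) (g c) ≡ 0ℚ
    geodesic-uncut c = cutVec-uncut H (walkPartition (geodesic c)) (g c)
      (trans (walkPartition-∈ (geodesic c) (start∈ _)) (sym (walkPartition-∈ (geodesic c) (end∈ _))))

    uncut⇒shorter : ∀ c′ c → c′ ≢ c → point (suc c′) (g c) ≢ 1ℚ → distance c < distance c′
    uncut⇒shorter c′ c c′≢c uncut =
      let merged  = cutVec≢1⇒uncut H (walkPartition (geodesic c′)) (g c) uncut
          s∈ , t∈ = walkPartition-merges (geodesic c′) (proj₁ simple (g c)) merged
          q , q⊆geodesic , shorter-or-same = subwalk (geodesic c′) s∈ t∈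
          same-edge = λ same → contradiction (g-injective (proj₂ simple (g c) (g c′) same)) (c′≢c ∘ sym)
      in  ℕ.≤-<-trans (distance-minimal c q (WithinPorQ-⊆ q⊆geodesic (geodesic-within c′)))
                      (subst (walkLength q <_) (geodesic-length c′) ([ id , same-edge ]′ shorter-or-same))

    independent : AffIndep (suc j) point
    independent = affIndep-triangular point g distance (identity-cuts ∘ g) geodesic-uncut uncut⇒shorter

    cut-outside : ∀ f → ¬ (P (end₁ H f) × P (end₂ H f)) → ¬ (Q (end₁ H f) × Q (end₂ H f)) →
                  ∀ i → point i f ≡ 1ℚ
    cut-outside f ¬P ¬Q zero    = identity-cuts f
    cut-outside f ¬P ¬Q (suc c) = cutVec-cut H (walkPartition (geodesic c)) f λ merged →
      let s∈ , t∈ = walkPartition-merges (geodesic c) (proj₁ simple f) merged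
      in  [ (λ Pp → ¬P (All.lookup Pp s∈ , All.lookup Pp t∈))
          , (λ Qp → ¬Q (All.lookup Qp s∈ , All.lookup Qp t∈)) ]′ (geodesic-within c)

multicut-rank : ∀ {n m} (H : LiftedGraph n m) → Simple H → ConnectedG H →
                AffRank (IsLiftedMulticut H) (suc m)
multicut-rank H simple connected =
  (point , point-multicut , independent) , λ _ v _ indep → affIndep-≤ v indep
  where
  open Walks H using (walkLength)
  open ShortestWalks H U? U? using (Admissible; module Family)
  admissible : ∀ f → ∃ λ ℓ → Admissible ℓ (end₁ H f) (end₂ H f)
  admissible f = walkLength p , p , refl , inj₁ (All.universal-U (walkNodes p))
    where p = connected (end₁ H f) (end₂ H f)
  open Family simple id id admissible

module _ {n m} (H : LiftedGraph n (suc m)) (simple : Simple H) (connected : ConnectedG H)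
         (e : Fin (suc m)) where

  open Walks H

  s t : Fin n
  s = end₁ H e
  t = end₂ H e

  Face : (Fin (suc m) → ℚ) → Set
  Face x = IsLiftedMulticut H x × x e ≡ 1ℚ

  Separated : Fin (suc m) → Set
  Separated f = CutNode H (end₁ H f) (end₂ H f) s × CutNode H (end₁ H f) (end₂ H f) t

  separated-cut : ∀ {f} x → Face x → Separated f → x f ≡ 1ℚ
  separated-cut {f} x ((π , π-decomposition , x≡cut) , xₑ≡1) (s-cut , t-cut) =
    trans (x≡cut f) (cutVec-cut H π f merged-absurd)
    where
    merged-absurd : π (end₁ H f) ≢ π (end₂ H f)
    merged-absurd same =
      let q , q! , q-in-block = block-path π-decomposition same
          s~t = trans (All.lookup q-in-block (s-cut q q!)) (sym (All.lookup q-in-block (t-cut q q!)))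
      in  ℚ.1≢0 (begin
            1ℚ           ≡⟨ xₑ≡1 ⟨
            x e          ≡⟨ x≡cut e ⟩
            cutVec H π e ≡⟨ cutVec-uncut H π e s~t ⟩
            0ℚ           ∎)
      where open ≡-Reasoning

  edge-cutNode : ∀ {f x} → inE H f ≡ true → CutNode H (end₁ H f) (end₂ H f) x →
                 x ≡ end₁ H f ⊎ x ≡ end₂ H f
  edge-cutNode {f} f∈E cut
    with cut (step (f , f∈E , inj₁ (refl , refl)) here) ((proj₁ simple f ∷ []) ∷ [] ∷ [])
  ... | here  x≡u        = inj₁ x≡u
  ... | there (here x≡v) = inj₂ x≡v

  separated-edge≡e : ∀ {f} → inE H f ≡ true → Separated f → f ≡ e
  separated-edge≡e {f} f∈E (s-cut , t-cut) =
    proj₂ simple f e (same-ends (edge-cutNode f∈E s-cut) (edge-cutNode f∈E t-cut))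
    where
    same-ends : s ≡ end₁ H f ⊎ s ≡ end₂ H f → t ≡ end₁ H f ⊎ t ≡ end₂ H f →
                SamePair (ends H f) (s , t)
    same-ends (inj₁ s≡u) (inj₂ t≡v) = inj₁ (sym s≡u , sym t≡v)
    same-ends (inj₂ s≡v) (inj₁ t≡u) = inj₂ (sym t≡u , sym s≡v)
    same-ends (inj₁ s≡u) (inj₁ t≡u) = contradiction (trans s≡u (sym t≡u)) (proj₁ simple e)
    same-ends (inj₂ s≡v) (inj₂ t≡v) = contradiction (trans s≡v (sym t≡v)) (proj₁ simple e)

  NoLiftedSeparated : Set
  NoLiftedSeparated = ∀ f → inE H f ≡ false → f ≢ e → ¬ Separated f

  module Avoiding = ShortestWalks H (λ x → ¬? (s Fin.≟ x)) (λ x → ¬? (t Fin.≟ x))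

  avoiding-connected : NoLiftedSeparated → ∀ c →
    ∃ λ ℓ → Avoiding.Admissible ℓ (end₁ H (punchIn e c)) (end₂ H (punchIn e c))
  avoiding-connected no-separated c
    with reachable? (λ x → ¬? (s Fin.≟ x)) (end₁ H f) (end₂ H f)
       | reachable? (λ x → ¬? (t Fin.≟ x)) (end₁ H f) (end₂ H f)
    where f = punchIn e c
  ... | yes (ℓ , p , ∣p∣ , avoids-s) | _ = ℓ , p , ∣p∣ , inj₁ avoids-s
  ... | no _ | yes (ℓ , p , ∣p∣ , avoids-t) = ℓ , p , ∣p∣ , inj₂ avoids-t
  ... | no s-unavoidable | no t-unavoidable =
    contradiction (unreachable⇒cutNode s-unavoidable , unreachable⇒cutNode t-unavoidable) not-separated
    where
    f = punchIn e c
    f≢e = Fin.punchInᵢ≢i e c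
    not-separated : ¬ Separated f
    not-separated with inE H f in f-kind
    ... | true  = f≢e ∘ separated-edge≡e f-kind
    ... | false = no-separated f f-kind f≢e

  face-rank : NoLiftedSeparated → AffRank Face (suc m)
  face-rank no-separated =
    (point , point-face , independent) ,
    λ _ v v∈face indep → affIndep-≤-constant v (proj₂ ∘ v∈face) indep
    where
    open Avoiding.Family simple (punchIn e) (Fin.punchIn-injective e _ _) (avoiding-connected no-separated)
    point-face : ∀ i → Face (point i)
    point-face i = point-multicut i , cut-outside e (λ (s≢s , _) → s≢s refl) (λ (_ , t≢t) → t≢t refl) i

  facet⇒unseparated : FacetXeLe1 H e → ∀ {f} → f ≢ e → ¬ Separated f
  facet⇒unseparated (r , (_ , maximal) , (v , v∈face , v-indep) , _) f≢e separated =
    let (u , u-multicut , u-indep) , _ = multicut-rank H simple connected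
        m<r = ℕ.≤-pred (maximal _ u u-multicut u-indep)
        r≤m = affIndep-≤-twoConstants v (f≢e ∘ sym) (proj₂ ∘ v∈face)
                (λ i → separated-cut (v i) (v∈face i) separated) v-indep
    in  ℕ.<⇒≱ m<r r≤m

theorem5p6 : ∀ {n m : ℕ} (H : LiftedGraph n m) → Simple H → ConnectedG H →
    (e : Fin m) →
    FacetXeLe1 H e ⇔
      (¬ (∃[ f ] (inE H f ≡ false × f ≢ e ×
          CutNode H (proj₁ (ends H f)) (proj₂ (ends H f)) (proj₁ (ends H e)) ×
          CutNode H (proj₁ (ends H f)) (proj₂ (ends H f)) (proj₂ (ends H e)))))
theorem5p6 {m = zero}  H simple connected ()
theorem5p6 {m = suc m} H simple connected e = mk⇔
  (λ facet (f , _ , f≢e , s-cut , t-cut) →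
     facet⇒unseparated H simple connected e facet f≢e (s-cut , t-cut))
  (λ no-separated → suc m , multicut-rank H simple connected ,
     face-rank H simple connected e
       (λ f f∉E f≢e (s-cut , t-cut) → no-separated (f , f∉E , f≢e , s-cut , t-cut)))
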